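{- Let $G$ be a finite simple bipartite graph. If $G$ is vertex decomposable, then $\mathrm{Shed}(G)$ is a dominating set of $G$.
   Context: All graphs are finite and simple. For a graph $G=(V,E)$ and $x\in V$, $G\setminus x$ is the graph obtained by deleting $x$ and its incident edges; $N(x)$ is the set of neighbours of $x$, $N[x]=N(x)\cup\{x\}$, and $G\setminus N[x]$ is obtained by deleting all vertices of $N[x]$ and their incident edges. A graph is well-covered if all its maximal independent sets have the same cardinality. A graph $G$ is vertex decomposable if $G$ is well-covered and either (i) $G$ has no edges (possibly no vertices), or (ii) there is a vertex $x$ such that both $G\setminus x$ and $G\setminus N[x]$ are vertex decomposable. For a vertex decomposable graph $G$, $\mathrm{Shed}(G)$ is the set of vertices $x$ such that $G\setminus x$ and $G\setminus N[x]$ are both vertex decomposable. A set $D\subseteq V$ is dominating if every vertex of $V\setminus D$ is adjacent to a vertex of $D$. -}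

module Defs where

open import Data.Nat using (ℕ)
open import Data.Bool using (Bool)
open import Data.Fin using (Fin)
open import Data.Fin.Subset using (Subset; _∈_; _⊆_; ⊤; _─_; _-_; ∣_∣; ⁅_⁆; _∪_)
open import Data.Vec using (tabulate)
open import Data.Product using (∃; _×_; _,_)
open import Data.Empty using (⊥)
open import Relation.Nullary using (¬_; Dec; does)
open import Relation.Binary.PropositionalEquality using (_≡_; _≢_)

record Graph (n : ℕ) : Set₁ where
  field
    Adj     : Fin n → Fin n → Set
    adj?    : (u v : Fin n) → Dec (Adj u v)
    sym     : ∀ {u v} → Adj u v → Adj v u
    irrefl  : ∀ {u} → ¬ Adj u u

module _ {n : ℕ} (G : Graph n) where
  open Graph G

  IsBipartite : Set
  IsBipartite = ∃ λ (c : Fin n → Bool) → ∀ {u v} → Adj u v → c u ≢ c v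

  -- Induced subgraphs of G are represented by their vertex sets S.

  N : Fin n → Subset n
  N x = tabulate (λ v → does (adj? x v))

  N[_] : Fin n → Subset n
  N[ x ] = ⁅ x ⁆ ∪ N x

  Independent : Subset n → Subset n → Set
  Independent S I = I ⊆ S × (∀ {u v} → u ∈ I → v ∈ I → ¬ Adj u v)

  MaximalIndependent : Subset n → Subset n → Set
  MaximalIndependent S I =
    Independent S I × (∀ J → Independent S J → I ⊆ J → J ⊆ I)

  WellCovered : Subset n → Set
  WellCovered S = ∀ I J → MaximalIndependent S I → MaximalIndependent S J → ∣ I ∣ ≡ ∣ J ∣

  NoEdges : Subset n → Set
  NoEdges S = ∀ {u v} → u ∈ S → v ∈ S → ¬ Adj u v

  -- vertex decomposability of G[S]; G[S] \ x is G[S - x],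
  -- G[S] \ N[x] is G[S ─ N[x]]
  data VertexDecomposable : Subset n → Set where
    vd-noEdges : ∀ {S} → WellCovered S → NoEdges S → VertexDecomposable S
    vd-shed    : ∀ {S} → WellCovered S → (x : Fin n) → x ∈ S →
                 VertexDecomposable (S - x) →
                 VertexDecomposable (S ─ N[ x ]) →
                 VertexDecomposable S

  InShed : Fin n → Set
  InShed x = VertexDecomposable (⊤ - x) × VertexDecomposable (⊤ ─ N[ x ])

  Dominating : (Fin n → Set) → Set
  Dominating D = ∀ v → ¬ D v → ∃ λ u → D u × Adj v u

module Submission where

-- The proof rests
-- on two facts that hold in every graph:
--   * vertex decomposability passes to links G[S] \ N[x] (vd-link) and survives
--     adding an isolated vertex (vd-insert), so an isolated vertex is a shedding
--     vertex, and so is every support vertex u of a leaf q, because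
--     G \ u = (G \ N[q]) + q with q isolated (isolated-sheds, support-sheds);
--   * a well-covered comparison of maximal independent sets, constructed greedily
--     (extend), which controls the neighbourhood of a shedding vertex.
-- For bipartite G this yields a leaf of each colour in every vertex decomposable
-- G[S] with an edge (leaf-of-colour), and then, by induction on |S| through links,
-- a support vertex next to every non-isolated vertex (support-neighbour).  A vertex
-- outside Shed(G) is not isolated, hence adjacent to a support vertex, which sheds.

open import Defs
open import Data.Nat using (ℕ; zero; suc; _≤_; _<_; s≤s)
open import Data.Nat.Properties
  using (≤-refl; ≤-trans; ≤-pred; suc-injective; n≮n; module ≤-Reasoning)
open import Data.Bool using (Bool; true)
open import Data.Bool.Properties using (¬-not) renaming (_≟_ to _≟ᵇ_)
open import Data.Fin using (Fin; zero; suc; _≟_)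
open import Data.Fin.Properties using (any?)
open import Data.Fin.Subset
  using (Subset; inside; outside; _∈_; _∉_; _⊆_; ⊤; _─_; _-_; ∣_∣; ⁅_⁆; _∪_)
open import Data.Fin.Subset.Properties
  using ( _∈?_; ∈⊤; ⊆-trans; x∈⁅x⁆; x∈⁅y⁆⇒x≡y; ⊆-antisym; p⊆p∪q; q⊆p∪q; x∈p∪q⁻
        ; ∪-identityʳ; p─⊥≡p; p─q⊆p; p─q─r≡p─r─q; x∈p∧x∉q⇒x∈p─q; x∈p∧x≢y⇒x∈p-y
        ; x∈p∩q⁺; p⊂q⇒∣p∣<∣q∣; x∈p⇒∣p-x∣<∣p∣; p∩q≢∅⇒∣p─q∣<∣p∣)
open import Data.Vec using (_∷_; here; there; tabulate)
open import Data.Vec.Properties using (lookup∘tabulate; []=⇒lookup; lookup⇒[]=)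
open import Data.List using (List; []; _∷_; allFin)
open import Data.List.Membership.Propositional using () renaming (_∈_ to _∈ˡ_)
open import Data.List.Membership.Propositional.Properties using (∈-allFin)
open import Data.List.Relation.Unary.Any using (here; there)
open import Data.Product using (∃; _×_; _,_; proj₁; proj₂)
open import Data.Sum using (_⊎_; inj₁; inj₂)
import Data.Sum as Sum
open import Data.Empty using (⊥; ⊥-elim)
open import Function using (_∘_)
open import Relation.Nullary using (¬_; Dec; yes; no; does)
open import Relation.Nullary.Decidable using (_×-dec_; ¬?)
open import Relation.Unary using (Decidable)
open import Relation.Binary.PropositionalEquality
  using (_≡_; _≢_; refl; sym; trans; cong; subst; subst₂; module ≡-Reasoning)

x∈q⇒x∉p─q : ∀ {n} (p q : Subset n) {x} → x ∈ q → x ∉ p ─ q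
x∈q⇒x∉p─q (s ∷ p) (inside ∷ q) here ()
x∈q⇒x∉p─q (s ∷ p) (t ∷ q) (there x∈q) (there x∈p─q) = x∈q⇒x∉p─q p q x∈q x∈p─q

x∈p-y⇒x∈p : ∀ {n} {p : Subset n} {x y} → x ∈ p - y → x ∈ p
x∈p-y⇒x∈p {p = p} {y = y} = p─q⊆p p ⁅ y ⁆

x∈p-y⇒x≢y : ∀ {n} (p : Subset n) {x y} → x ∈ p - y → x ≢ y
x∈p-y⇒x≢y p {y = y} x∈p-y refl = x∈q⇒x∉p─q p ⁅ y ⁆ (x∈⁅x⁆ y) x∈p-y

x∈p∪⁅y⁆⁻ : ∀ {n} (p : Subset n) {x y} → x ∈ p ∪ ⁅ y ⁆ → x ∈ p ⊎ x ≡ y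
x∈p∪⁅y⁆⁻ p {y = y} h = Sum.map₂ (x∈⁅y⁆⇒x≡y y) (x∈p∪q⁻ p ⁅ y ⁆ h)

x∈p∪⁅y⁆∧x≢y⇒x∈p : ∀ {n} (p : Subset n) {x y} → x ∈ p ∪ ⁅ y ⁆ → x ≢ y → x ∈ p
x∈p∪⁅y⁆∧x≢y⇒x∈p p h x≢y = Sum.[ (λ x∈p → x∈p) , (λ x≡y → ⊥-elim (x≢y x≡y)) ] (x∈p∪⁅y⁆⁻ p h)

y∈p∪⁅y⁆ : ∀ {n} (p : Subset n) y → y ∈ p ∪ ⁅ y ⁆
y∈p∪⁅y⁆ p y = q⊆p∪q p ⁅ y ⁆ (x∈⁅x⁆ y)

p∪⁅y⁆⊆q : ∀ {n} {p q : Subset n} {y} → p ⊆ q → y ∈ q → p ∪ ⁅ y ⁆ ⊆ q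
p∪⁅y⁆⊆q {p = p} p⊆q y∈q h with x∈p∪⁅y⁆⁻ p h
... | inj₁ x∈p = p⊆q x∈p
... | inj₂ refl = y∈q

∣p∣≡1+∣p-x∣ : ∀ {n} (p : Subset n) {x} → x ∈ p → ∣ p ∣ ≡ suc ∣ p - x ∣
∣p∣≡1+∣p-x∣ (inside ∷ p) here = cong suc (sym (cong ∣_∣ (p─⊥≡p p)))
∣p∣≡1+∣p-x∣ (inside ∷ p) (there x∈p) = cong suc (∣p∣≡1+∣p-x∣ p x∈p)
∣p∣≡1+∣p-x∣ (outside ∷ p) (there x∈p) = ∣p∣≡1+∣p-x∣ p x∈p

∣p∪⁅x⁆∣≡1+∣p∣ : ∀ {n} (p : Subset n) {x} → x ∉ p → ∣ p ∪ ⁅ x ⁆ ∣ ≡ suc ∣ p ∣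
∣p∪⁅x⁆∣≡1+∣p∣ (outside ∷ p) {zero} _ = cong (suc ∘ ∣_∣) (∪-identityʳ p)
∣p∪⁅x⁆∣≡1+∣p∣ (inside ∷ p) {zero} x∉p = ⊥-elim (x∉p here)
∣p∪⁅x⁆∣≡1+∣p∣ (outside ∷ p) {suc x} x∉p = ∣p∪⁅x⁆∣≡1+∣p∣ p (x∉p ∘ there)
∣p∪⁅x⁆∣≡1+∣p∣ (inside ∷ p) {suc x} x∉p = cong suc (∣p∪⁅x⁆∣≡1+∣p∣ p (x∉p ∘ there))

∣p∣+2≤∣q∣ : ∀ {n} {p q : Subset n} {x y} → p ⊆ q → x ∈ q → y ∈ q → x ≢ y →
            x ∉ p → y ∉ p → suc (suc ∣ p ∣) ≤ ∣ q ∣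
∣p∣+2≤∣q∣ {p = p} {q} {x} {y} p⊆q x∈q y∈q x≢y x∉p y∉p =
  ≤-trans (s≤s (p⊂q⇒∣p∣<∣q∣ (p⊆q-x , y , x∈p∧x≢y⇒x∈p-y y∈q (x≢y ∘ sym) , y∉p)))
          (x∈p⇒∣p-x∣<∣p∣ x∈q)
  where
  p⊆q-x : p ⊆ q - x
  p⊆q-x {z} z∈p = x∈p∧x≢y⇒x∈p-y (p⊆q z∈p) λ { refl → x∉p z∈p }

─-∪⁅⁆-comm : ∀ {n} (p r : Subset n) {y} → y ∉ r → (p ─ r) ∪ ⁅ y ⁆ ≡ (p ∪ ⁅ y ⁆) ─ r
─-∪⁅⁆-comm p r {y} y∉r = ⊆-antisym into back
  where
  into : (p ─ r) ∪ ⁅ y ⁆ ⊆ (p ∪ ⁅ y ⁆) ─ r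
  into h with x∈p∪⁅y⁆⁻ (p ─ r) h
  ... | inj₁ x∈p─r = x∈p∧x∉q⇒x∈p─q (p⊆p∪q ⁅ y ⁆ (p─q⊆p p r x∈p─r))
                                   (λ x∈r → x∈q⇒x∉p─q p r x∈r x∈p─r)
  ... | inj₂ refl = x∈p∧x∉q⇒x∈p─q (y∈p∪⁅y⁆ p y) y∉r
  back : (p ∪ ⁅ y ⁆) ─ r ⊆ (p ─ r) ∪ ⁅ y ⁆
  back h with x∈p∪⁅y⁆⁻ p (p─q⊆p (p ∪ ⁅ y ⁆) r h)
  ... | inj₁ x∈p = p⊆p∪q ⁅ y ⁆ (x∈p∧x∉q⇒x∈p─q x∈p (λ x∈r → x∈q⇒x∉p─q _ r x∈r h))
  ... | inj₂ refl = y∈p∪⁅y⁆ (p ─ r) y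

p-y─q≡p─q : ∀ {n} (p q : Subset n) {y} → y ∈ q → (p - y) ─ q ≡ p ─ q
p-y─q≡p─q p q {y} y∈q = ⊆-antisym into back
  where
  into : (p - y) ─ q ⊆ p ─ q
  into h = x∈p∧x∉q⇒x∈p─q (x∈p-y⇒x∈p (p─q⊆p (p - y) q h)) (λ x∈q → x∈q⇒x∉p─q _ q x∈q h)
  back : p ─ q ⊆ (p - y) ─ q
  back h = x∈p∧x∉q⇒x∈p─q
    (x∈p∧x≢y⇒x∈p-y (p─q⊆p p q h) λ { refl → x∈q⇒x∉p─q p q y∈q h })
    (λ x∈q → x∈q⇒x∉p─q p q x∈q h)

select : ∀ {n} {P : Fin n → Set} → Decidable P → Subset n
select P? = tabulate (λ i → does (P? i))

∈select⁻ : ∀ {n} {P : Fin n → Set} (P? : Decidable P) {x} → x ∈ select P? → P x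
∈select⁻ P? {x} x∈ with P? x | trans (sym (lookup∘tabulate (λ i → does (P? i)) x)) ([]=⇒lookup x∈)
... | yes px | _ = px
... | no _ | ()

∈select⁺ : ∀ {n} {P : Fin n → Set} (P? : Decidable P) {x} → P x → x ∈ select P?
∈select⁺ P? {x} px = lookup⇒[]= x (select P?) (trans (lookup∘tabulate (λ i → does (P? i)) x) holds)
  where
  holds : does (P? x) ≡ true
  holds with P? x
  ... | yes _ = refl
  ... | no ¬px = ⊥-elim (¬px px)

≢-≢⇒≡ : ∀ {a b d : Bool} → a ≢ b → b ≢ d → a ≡ d
≢-≢⇒≡ a≢b b≢d = trans (¬-not a≢b) (sym (¬-not (b≢d ∘ sym)))

module GraphFacts {n : ℕ} (G : Graph n) where
  open Graph G renaming (sym to adj-sym)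

  N[_]ᴳ : Fin n → Subset n
  N[ x ]ᴳ = N[_] G x

  Ind : Subset n → Subset n → Set
  Ind = Independent G

  Max : Subset n → Subset n → Set
  Max = MaximalIndependent G

  WC : Subset n → Set
  WC = WellCovered G

  NE : Subset n → Set
  NE = NoEdges G

  VD : Subset n → Set
  VD = VertexDecomposable G

  NoNeighbourIn : Subset n → Fin n → Set
  NoNeighbourIn T x = ∀ {z} → z ∈ T → ¬ Adj x z

  Leaf : Subset n → Fin n → Fin n → Set
  Leaf S q u = u ∈ S × Adj q u × (∀ {z} → z ∈ S → Adj q z → z ≡ u)

  Support : Subset n → Fin n → Set
  Support S u = ∃ λ q → q ∈ S × Leaf S q u

  Edge : Subset n → Set
  Edge S = ∃ λ x → ∃ λ y → x ∈ S × y ∈ S × Adj x y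

  edge? : ∀ S → Dec (Edge S)
  edge? S = any? λ x → any? λ y → (x ∈? S) ×-dec (y ∈? S) ×-dec adj? x y

  ∈N[]⁻ : ∀ {x y} → y ∈ N[ x ]ᴳ → y ≡ x ⊎ Adj x y
  ∈N[]⁻ {x} h = Sum.map (x∈⁅y⁆⇒x≡y x) (∈select⁻ (adj? x)) (x∈p∪q⁻ ⁅ x ⁆ (N G x) h)

  x∈N[x] : ∀ x → x ∈ N[ x ]ᴳ
  x∈N[x] x = p⊆p∪q (N G x) (x∈⁅x⁆ x)

  adj⇒∈N[] : ∀ {x y} → Adj x y → y ∈ N[ x ]ᴳ
  adj⇒∈N[] {x} a = q⊆p∪q ⁅ x ⁆ (N G x) (∈select⁺ (adj? x) a)

  ∈S─N[x]⇒∈S : ∀ {S x y} → y ∈ S ─ N[ x ]ᴳ → y ∈ S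
  ∈S─N[x]⇒∈S {S} {x} = p─q⊆p S N[ x ]ᴳ

  ∈S─N[x]⇒≢ : ∀ {S x y} → y ∈ S ─ N[ x ]ᴳ → y ≢ x
  ∈S─N[x]⇒≢ {S} {x} h refl = x∈q⇒x∉p─q S N[ x ]ᴳ (x∈N[x] x) h

  ∈S─N[x]⇒≁ : ∀ {S x y} → y ∈ S ─ N[ x ]ᴳ → ¬ Adj x y
  ∈S─N[x]⇒≁ {S} {x} h x~y = x∈q⇒x∉p─q S N[ x ]ᴳ (adj⇒∈N[] x~y) h

  ∈─N[]⁺ : ∀ {S x y} → y ∈ S → y ≢ x → ¬ Adj x y → y ∈ S ─ N[ x ]ᴳ
  ∈─N[]⁺ y∈S y≢x ¬a = x∈p∧x∉q⇒x∈p─q y∈S λ h → Sum.[ y≢x , ¬a ] (∈N[]⁻ h)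

  noEdges-⊆ : ∀ {S T} → T ⊆ S → NE S → NE T
  noEdges-⊆ T⊆S ne u∈T v∈T = ne (T⊆S u∈T) (T⊆S v∈T)

  noEdges-insert : ∀ {I x} → NE I → NoNeighbourIn I x → NE (I ∪ ⁅ x ⁆)
  noEdges-insert {I} ne x⊥I hu hv with x∈p∪⁅y⁆⁻ I hu | x∈p∪⁅y⁆⁻ I hv
  ... | inj₁ u∈I | inj₁ v∈I = ne u∈I v∈I
  ... | inj₁ u∈I | inj₂ refl = x⊥I u∈I ∘ adj-sym
  ... | inj₂ refl | inj₁ v∈I = x⊥I v∈I
  ... | inj₂ refl | inj₂ refl = irrefl

  independent-insert : ∀ {S I x} → Ind S I → x ∈ S → NoNeighbourIn I x → Ind S (I ∪ ⁅ x ⁆)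
  independent-insert (I⊆S , ne) x∈S x⊥I = p∪⁅y⁆⊆q I⊆S x∈S , noEdges-insert ne x⊥I

  -- Greedy extension of an independent set to a maximal one: a vertex i is
  -- settled for M when it is in M, outside S, or has a neighbour in M.
  Settled : Subset n → Subset n → Fin n → Set
  Settled S M i = i ∈ M ⊎ i ∉ S ⊎ ∃ λ m → m ∈ M × Adj i m

  settled-mono : ∀ {S M M' i} → M ⊆ M' → Settled S M i → Settled S M' i
  settled-mono M⊆M' = Sum.map M⊆M' (Sum.map₂ λ (m , m∈M , a) → m , M⊆M' m∈M , a)

  settle : ∀ {S M} → Ind S M → ∀ i → ∃ λ M' → Ind S M' × M ⊆ M' × Settled S M' i
  settle {S} {M} indM i with i ∈? S | any? (λ m → (m ∈? M) ×-dec adj? i m)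
  ... | no i∉S | _ = M , indM , (λ m → m) , inj₂ (inj₁ i∉S)
  ... | yes _ | yes nbr = M , indM , (λ m → m) , inj₂ (inj₂ nbr)
  ... | yes i∈S | no ¬nbr =
    M ∪ ⁅ i ⁆ , independent-insert indM i∈S (λ m∈M a → ¬nbr (_ , m∈M , a)) ,
    p⊆p∪q ⁅ i ⁆ , inj₁ (y∈p∪⁅y⁆ M i)

  settle-all : ∀ {S M} → Ind S M → (is : List (Fin n)) →
               ∃ λ M' → Ind S M' × M ⊆ M' × (∀ {i} → i ∈ˡ is → Settled S M' i)
  settle-all indM [] = _ , indM , (λ m → m) , λ ()
  settle-all indM (i ∷ is) with settle indM i
  ... | M₁ , ind₁ , M⊆M₁ , i-settled with settle-all ind₁ is
  ... | M₂ , ind₂ , M₁⊆M₂ , is-settled =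
    M₂ , ind₂ , ⊆-trans M⊆M₁ M₁⊆M₂ ,
    λ { (here refl) → settled-mono M₁⊆M₂ i-settled ; (there i∈is) → is-settled i∈is }

  settled⇒maximal : ∀ {S M} → Ind S M → (∀ i → Settled S M i) → Max S M
  settled⇒maximal {S} {M} indM settled = indM , saturated
    where
    saturated : ∀ J → Ind S J → M ⊆ J → J ⊆ M
    saturated J (J⊆S , neJ) M⊆J {j} j∈J with settled j
    ... | inj₁ j∈M = j∈M
    ... | inj₂ (inj₁ j∉S) = ⊥-elim (j∉S (J⊆S j∈J))
    ... | inj₂ (inj₂ (m , m∈M , a)) = ⊥-elim (neJ j∈J (M⊆J m∈M) a)

  extend : ∀ {S J} → Ind S J → ∃ λ M → Max S M × J ⊆ M
  extend indJ with settle-all indJ (allFin n)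
  ... | M , indM , J⊆M , settled = M , settled⇒maximal indM (λ i → settled (∈-allFin i)) , J⊆M

  x∉S─N[x] : ∀ S x → x ∉ S ─ N[ x ]ᴳ
  x∉S─N[x] S x = x∈q⇒x∉p─q S N[ x ]ᴳ (x∈N[x] x)

  maximal-link⇒maximal : ∀ {S x I} → x ∈ S → Max (S ─ N[ x ]ᴳ) I → Max S (I ∪ ⁅ x ⁆)
  maximal-link⇒maximal {S} {x} {I} x∈S ((I⊆L , neI) , maxI) = independent , saturated
    where
    independent : Ind S (I ∪ ⁅ x ⁆)
    independent = independent-insert ((λ i∈I → ∈S─N[x]⇒∈S (I⊆L i∈I)) , neI) x∈S
                                     (λ i∈I → ∈S─N[x]⇒≁ (I⊆L i∈I))
    saturated : ∀ J → Ind S J → I ∪ ⁅ x ⁆ ⊆ J → J ⊆ I ∪ ⁅ x ⁆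
    saturated J (J⊆S , neJ) I+x⊆J {j} j∈J with j ≟ x
    ... | yes refl = y∈p∪⁅y⁆ I x
    ... | no j≢x = p⊆p∪q ⁅ x ⁆ (maxI (J - x) (J-x⊆L , noEdges-⊆ x∈p-y⇒x∈p neJ) I⊆J-x
                                     (x∈p∧x≢y⇒x∈p-y j∈J j≢x))
      where
      J-x⊆L : J - x ⊆ S ─ N[ x ]ᴳ
      J-x⊆L h = ∈─N[]⁺ (J⊆S (x∈p-y⇒x∈p h)) (x∈p-y⇒x≢y J h)
                       (neJ (I+x⊆J (y∈p∪⁅y⁆ I x)) (x∈p-y⇒x∈p h))
      I⊆J-x : I ⊆ J - x
      I⊆J-x i∈I = x∈p∧x≢y⇒x∈p-y (I+x⊆J (p⊆p∪q ⁅ x ⁆ i∈I)) (∈S─N[x]⇒≢ (I⊆L i∈I))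

  wc-link : ∀ {S x} → WC S → x ∈ S → WC (S ─ N[ x ]ᴳ)
  wc-link {S} {x} wc x∈S I J maxI maxJ = suc-injective (begin
    suc ∣ I ∣          ≡⟨ sym (∣p∪⁅x⁆∣≡1+∣p∣ I (x∉ maxI)) ⟩
    ∣ I ∪ ⁅ x ⁆ ∣      ≡⟨ wc _ _ (maximal-link⇒maximal x∈S maxI) (maximal-link⇒maximal x∈S maxJ) ⟩
    ∣ J ∪ ⁅ x ⁆ ∣      ≡⟨ ∣p∪⁅x⁆∣≡1+∣p∣ J (x∉ maxJ) ⟩
    suc ∣ J ∣          ∎)
    where
    open ≡-Reasoning
    x∉ : ∀ {K} → Max (S ─ N[ x ]ᴳ) K → x ∉ K
    x∉ ((K⊆L , _) , _) x∈K = x∉S─N[x] S x (K⊆L x∈K)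

  maximal-insert⁻ : ∀ {T q I} → q ∉ T → NoNeighbourIn T q →
                    Max (T ∪ ⁅ q ⁆) I → q ∈ I × Max T (I - q)
  maximal-insert⁻ {T} {q} {I} q∉T q⊥T ((I⊆T+q , neI) , maxI) =
    q∈I , (I-q⊆T , noEdges-⊆ x∈p-y⇒x∈p neI) , saturated
    where
    q⊥T+q : NoNeighbourIn (T ∪ ⁅ q ⁆) q
    q⊥T+q h with x∈p∪⁅y⁆⁻ T h
    ... | inj₁ z∈T = q⊥T z∈T
    ... | inj₂ refl = irrefl
    q∈I : q ∈ I
    q∈I = maxI (I ∪ ⁅ q ⁆) (independent-insert (I⊆T+q , neI) (y∈p∪⁅y⁆ T q) (q⊥T+q ∘ I⊆T+q))
               (p⊆p∪q ⁅ q ⁆) (y∈p∪⁅y⁆ I q)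
    I-q⊆T : I - q ⊆ T
    I-q⊆T h = x∈p∪⁅y⁆∧x≢y⇒x∈p T (I⊆T+q (x∈p-y⇒x∈p h)) (x∈p-y⇒x≢y I h)
    saturated : ∀ J → Ind T J → I - q ⊆ J → J ⊆ I - q
    saturated J (J⊆T , neJ) I-q⊆J {j} j∈J =
      x∈p∧x≢y⇒x∈p-y (maxI (J ∪ ⁅ q ⁆) J+q-independent I⊆J+q (p⊆p∪q ⁅ q ⁆ j∈J))
                    (λ { refl → q∉T (J⊆T j∈J) })
      where
      J+q-independent : Ind (T ∪ ⁅ q ⁆) (J ∪ ⁅ q ⁆)
      J+q-independent = independent-insert ((λ h → p⊆p∪q ⁅ q ⁆ (J⊆T h)) , neJ) (y∈p∪⁅y⁆ T q)
                                           (q⊥T ∘ J⊆T)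
      I⊆J+q : I ⊆ J ∪ ⁅ q ⁆
      I⊆J+q {i} i∈I with i ≟ q
      ... | yes refl = y∈p∪⁅y⁆ J q
      ... | no i≢q = p⊆p∪q ⁅ q ⁆ (I-q⊆J (x∈p∧x≢y⇒x∈p-y i∈I i≢q))

  wc-insert : ∀ {T q} → WC T → q ∉ T → NoNeighbourIn T q → WC (T ∪ ⁅ q ⁆)
  wc-insert {q = q} wc q∉T q⊥T I J maxI maxJ
    with maximal-insert⁻ q∉T q⊥T maxI | maximal-insert⁻ q∉T q⊥T maxJ
  ... | q∈I , maxI-q | q∈J , maxJ-q = begin
    ∣ I ∣          ≡⟨ ∣p∣≡1+∣p-x∣ I q∈I ⟩
    suc ∣ I - q ∣  ≡⟨ cong suc (wc _ _ maxI-q maxJ-q) ⟩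
    suc ∣ J - q ∣  ≡⟨ sym (∣p∣≡1+∣p-x∣ J q∈J) ⟩
    ∣ J ∣          ∎
    where open ≡-Reasoning

  vd⇒wc : ∀ {S} → VD S → WC S
  vd⇒wc (vd-noEdges wc _) = wc
  vd⇒wc (vd-shed wc _ _ _ _) = wc

  -- Links of vertex decomposable graphs are vertex decomposable (induction on the
  -- decomposition: shedding at x itself, at a neighbour of x, or at a vertex
  -- outside N[x], which remains a shedding vertex of the link).
  vd-link : ∀ {S x} → VD S → x ∈ S → VD (S ─ N[ x ]ᴳ)
  vd-link {S} (vd-noEdges wc ne) x∈S = vd-noEdges (wc-link wc x∈S) (noEdges-⊆ (p─q⊆p S _) ne)
  vd-link {S} {x} (vd-shed wc s s∈S vd₁ vd₂) x∈S with x ≟ s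
  ... | yes refl = vd₂
  ... | no x≢s with adj? x s
  ... | yes x~s =
    subst VD (p-y─q≡p─q S N[ x ]ᴳ (adj⇒∈N[] x~s)) (vd-link vd₁ (x∈p∧x≢y⇒x∈p-y x∈S x≢s))
  ... | no x≁s =
    vd-shed (wc-link wc x∈S) s (∈─N[]⁺ s∈S (x≢s ∘ sym) x≁s)
      (subst VD (p─q─r≡p─r─q S ⁅ s ⁆ N[ x ]ᴳ) (vd-link vd₁ (x∈p∧x≢y⇒x∈p-y x∈S x≢s)))
      (subst VD (p─q─r≡p─r─q S N[ s ]ᴳ N[ x ]ᴳ) (vd-link vd₂ (∈─N[]⁺ x∈S x≢s (x≁s ∘ adj-sym))))

  vd-insert : ∀ {T q} → VD T → q ∉ T → NoNeighbourIn T q → VD (T ∪ ⁅ q ⁆)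
  vd-insert (vd-noEdges wc ne) q∉T q⊥T =
    vd-noEdges (wc-insert wc q∉T q⊥T) (noEdges-insert ne q⊥T)
  vd-insert {T} {q} (vd-shed wc s s∈T vd₁ vd₂) q∉T q⊥T =
    vd-shed (wc-insert wc q∉T q⊥T) s (p⊆p∪q ⁅ q ⁆ s∈T)
      (subst VD (─-∪⁅⁆-comm T ⁅ s ⁆ q∉⁅s⁆)
             (vd-insert vd₁ (λ h → q∉T (x∈p-y⇒x∈p h)) (λ h → q⊥T (x∈p-y⇒x∈p h))))
      (subst VD (─-∪⁅⁆-comm T N[ s ]ᴳ q∉N[s])
             (vd-insert vd₂ (λ h → q∉T (p─q⊆p T _ h)) (λ h → q⊥T (p─q⊆p T _ h))))
    where
    q∉⁅s⁆ : q ∉ ⁅ s ⁆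
    q∉⁅s⁆ h with x∈⁅y⁆⇒x≡y s h
    ... | refl = q∉T s∈T
    q∉N[s] : q ∉ N[ s ]ᴳ
    q∉N[s] h with ∈N[]⁻ h
    ... | inj₁ refl = q∉T s∈T
    ... | inj₂ s~q = q⊥T s∈T (adj-sym s~q)

  S─N[x]≡S-x : ∀ {S x} → NoNeighbourIn S x → S ─ N[ x ]ᴳ ≡ S - x
  S─N[x]≡S-x {S} {x} x⊥S = ⊆-antisym into back
    where
    into : S ─ N[ x ]ᴳ ⊆ S - x
    into h = x∈p∧x≢y⇒x∈p-y (∈S─N[x]⇒∈S h) (∈S─N[x]⇒≢ h)
    back : S - x ⊆ S ─ N[ x ]ᴳ
    back h = ∈─N[]⁺ (x∈p-y⇒x∈p h) (x∈p-y⇒x≢y S h) (x⊥S (x∈p-y⇒x∈p h))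

  isolated-sheds : ∀ {S x} → VD S → x ∈ S → NoNeighbourIn S x → VD (S - x) × VD (S ─ N[ x ]ᴳ)
  isolated-sheds vd x∈S x⊥S = subst VD (S─N[x]≡S-x x⊥S) (vd-link vd x∈S) , vd-link vd x∈S

  S-u≡S─N[q]+q : ∀ {S q u} → q ∈ S → Leaf S q u → S - u ≡ (S ─ N[ q ]ᴳ) ∪ ⁅ q ⁆
  S-u≡S─N[q]+q {S} {q} {u} q∈S (_ , q~u , only-u) = ⊆-antisym into back
    where
    into : S - u ⊆ (S ─ N[ q ]ᴳ) ∪ ⁅ q ⁆
    into {y} h with y ≟ q
    ... | yes refl = y∈p∪⁅y⁆ _ q
    ... | no y≢q = p⊆p∪q ⁅ q ⁆ (∈─N[]⁺ (x∈p-y⇒x∈p h) y≢q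
                                       (λ q~y → x∈p-y⇒x≢y S h (only-u (x∈p-y⇒x∈p h) q~y)))
    back : (S ─ N[ q ]ᴳ) ∪ ⁅ q ⁆ ⊆ S - u
    back h with x∈p∪⁅y⁆⁻ (S ─ N[ q ]ᴳ) h
    ... | inj₁ y∈L = x∈p∧x≢y⇒x∈p-y (∈S─N[x]⇒∈S y∈L) λ { refl → ∈S─N[x]⇒≁ y∈L q~u }
    ... | inj₂ refl = x∈p∧x≢y⇒x∈p-y q∈S λ { refl → irrefl q~u }

  support-sheds : ∀ {S u} → VD S → Support S u → VD (S - u) × VD (S ─ N[ u ]ᴳ)
  support-sheds {S} vd (q , q∈S , leaf@(u∈S , _ , _)) =
    subst VD (sym (S-u≡S─N[q]+q q∈S leaf))
          (vd-insert (vd-link vd q∈S) (x∉S─N[x] S q) ∈S─N[x]⇒≁) ,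
    vd-link vd u∈S

  singleton-independent : ∀ {S x} → x ∈ S → Ind S ⁅ x ⁆
  singleton-independent {x = x} x∈S =
    (λ h → subst (_∈ _) (sym (x∈⁅y⁆⇒x≡y x h)) x∈S) ,
    λ hu hv → subst₂ (λ u v → ¬ Adj u v) (sym (x∈⁅y⁆⇒x≡y x hu)) (sym (x∈⁅y⁆⇒x≡y x hv)) irrefl

  maximal-deletion⇒maximal : ∀ {S s I t} → Max (S - s) I → t ∈ I → Adj s t → Max S I
  maximal-deletion⇒maximal ((I⊆S-s , neI) , maxI) t∈I s~t =
    ((λ i∈I → x∈p-y⇒x∈p (I⊆S-s i∈I)) , neI) ,
    λ J (J⊆S , neJ) I⊆J → maxI J ((λ j∈J → x∈p∧x≢y⇒x∈p-y (J⊆S j∈J)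
                                      λ { refl → neJ j∈J (I⊆J t∈I) s~t }) , neJ) I⊆J

  -- If G[S] and G[S] \ s are well-covered and s is not isolated in S, every maximal
  -- independent set I of G[S] \ s meets N(s): otherwise I + s extends to a maximal
  -- independent set of G[S] larger than one through a neighbour t of s.
  maximal-deletion-meets-N : ∀ {S s t I} → WC S → WC (S - s) → s ∈ S → t ∈ S → Adj s t →
                             Max (S - s) I → ∃ λ i → i ∈ I × Adj s i
  maximal-deletion-meets-N {S} {s} {t} {I} wcS wcS-s s∈S t∈S s~t maxI
    with any? (λ i → (i ∈? I) ×-dec adj? s i)
  ... | yes meets = meets
  ... | no ¬meets = ⊥-elim (too-large (extend I+s-independent) (extend t-independent))
    where
    I⊆S : I ⊆ S
    I⊆S i∈I = x∈p-y⇒x∈p (proj₁ (proj₁ maxI) i∈I)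
    s∉I : s ∉ I
    s∉I s∈I = x∈p-y⇒x≢y S (proj₁ (proj₁ maxI) s∈I) refl
    I+s-independent : Ind S (I ∪ ⁅ s ⁆)
    I+s-independent = independent-insert (I⊆S , proj₂ (proj₁ maxI)) s∈S
                                         (λ i∈I s~i → ¬meets (_ , i∈I , s~i))
    t-independent : Ind (S - s) ⁅ t ⁆
    t-independent = singleton-independent (x∈p∧x≢y⇒x∈p-y t∈S λ { refl → irrefl s~t })
    too-large : (∃ λ M → Max S M × I ∪ ⁅ s ⁆ ⊆ M) → (∃ λ K → Max (S - s) K × ⁅ t ⁆ ⊆ K) → ⊥
    too-large (M , maxM , I+s⊆M) (K , maxK , t∈K) = n≮n ∣ I ∣ (begin-strict
      ∣ I ∣  <⟨ p⊂q⇒∣p∣<∣q∣ ((λ i∈I → I+s⊆M (p⊆p∪q ⁅ s ⁆ i∈I)) , s , I+s⊆M (y∈p∪⁅y⁆ I s) , s∉I) ⟩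
      ∣ M ∣  ≡⟨ wcS M K maxM (maximal-deletion⇒maximal maxK (t∈K (x∈⁅x⁆ t)) s~t) ⟩
      ∣ K ∣  ≡⟨ wcS-s K I maxK maxI ⟩
      ∣ I ∣  ∎)
      where open ≤-Reasoning

  -- If G[S] is well-covered and G[S] \ s is edgeless, s has at most one neighbour
  -- in S: a maximal set through s misses two neighbours that S \ s contains.
  edgeless-deletion⇒unique-nbr : ∀ {S s w z} → WC S → s ∈ S → NE (S - s) →
                                 w ∈ S → z ∈ S → Adj s w → Adj s z → z ≡ w
  edgeless-deletion⇒unique-nbr {S} {s} {w} {z} wc s∈S neS-s w∈S z∈S s~w s~z with z ≟ w
  ... | yes z≡w = z≡w
  ... | no z≢w = ⊥-elim (too-large (extend (singleton-independent s∈S))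
                                   (extend (x∈p-y⇒x∈p , neS-s)))
    where
    too-large : (∃ λ M → Max S M × ⁅ s ⁆ ⊆ M) → (∃ λ J → Max S J × S - s ⊆ J) → ⊥
    too-large (M , maxM@((M⊆S , neM) , _) , s∈M) (J , maxJ , S-s⊆J) =
      n≮n (suc ∣ M - s ∣) (begin-strict
      suc ∣ M - s ∣  <⟨ ∣p∣+2≤∣q∣ M-s⊆J (in-J z∈S s~z) (in-J w∈S s~w) z≢w
                                  (outside-M s~z) (outside-M s~w) ⟩
      ∣ J ∣          ≡⟨ wc J M maxJ maxM ⟩
      ∣ M ∣          ≡⟨ ∣p∣≡1+∣p-x∣ M (s∈M (x∈⁅x⁆ s)) ⟩
      suc ∣ M - s ∣  ∎)
      where
      open ≤-Reasoning
      M-s⊆J : M - s ⊆ J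
      M-s⊆J h = S-s⊆J (x∈p∧x≢y⇒x∈p-y (M⊆S (x∈p-y⇒x∈p h)) (x∈p-y⇒x≢y M h))
      in-J : ∀ {y} → y ∈ S → Adj s y → y ∈ J
      in-J y∈S s~y = S-s⊆J (x∈p∧x≢y⇒x∈p-y y∈S λ { refl → irrefl s~y })
      outside-M : ∀ {y} → Adj s y → y ∉ M - s
      outside-M s~y h = neM (s∈M (x∈⁅x⁆ s)) (x∈p-y⇒x∈p h) s~y

  edge-through : ∀ {S s} → Edge S → ¬ Edge (S - s) → ∃ λ t → t ∈ S × Adj s t
  edge-through {s = s} (x , y , x∈S , y∈S , x~y) ¬edge with x ≟ s | y ≟ s
  ... | yes refl | _ = y , y∈S , x~y
  ... | no _ | yes refl = x , x∈S , adj-sym x~y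
  ... | no x≢s | no y≢s =
    ⊥-elim (¬edge (x , y , x∈p∧x≢y⇒x∈p-y x∈S x≢s , x∈p∧x≢y⇒x∈p-y y∈S y≢s , x~y))

  leaf-deletion⇒leaf : ∀ {S s ℓ p} → Leaf (S - s) ℓ p → ¬ Adj ℓ s → Leaf S ℓ p
  leaf-deletion⇒leaf (p∈S-s , ℓ~p , only-p) ℓ≁s =
    x∈p-y⇒x∈p p∈S-s , ℓ~p ,
    λ z∈S ℓ~z → only-p (x∈p∧x≢y⇒x∈p-y z∈S λ { refl → ℓ≁s ℓ~z }) ℓ~z

  leaf-link⇒leaf : ∀ {S p q u} → Leaf (S ─ N[ p ]ᴳ) q u → q ∈ S ─ N[ p ]ᴳ →
                   (∀ {z} → Adj p z → ¬ Adj q z) → Leaf S q u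
  leaf-link⇒leaf (u∈L , q~u , only-u) q∈L disjoint =
    ∈S─N[x]⇒∈S u∈L , q~u ,
    λ z∈S q~z → only-u (∈─N[]⁺ z∈S (λ { refl → ∈S─N[x]⇒≁ q∈L (adj-sym q~z) })
                                   (λ p~z → disjoint p~z q~z)) q~z

module Bipartite {n : ℕ} (G : Graph n) (c : Fin n → Bool)
                 (proper : ∀ {u v} → Graph.Adj G u v → c u ≢ c v) where
  open Graph G renaming (sym to adj-sym)
  open GraphFacts G

  same-colour : ∀ {u v w} → Adj u v → Adj v w → c u ≡ c w
  same-colour u~v v~w = ≢-≢⇒≡ (proper u~v) (proper v~w)

  in-class? : ∀ S s → Decidable λ z → z ∈ S × z ≢ s × c z ≡ c s
  in-class? S s z = (z ∈? S) ×-dec ¬? (z ≟ s) ×-dec (c z ≟ᵇ c s)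

  colour-class : Subset n → Fin n → Subset n
  colour-class S s = select (in-class? S s)

  colour-class-independent : ∀ S s → Ind (S - s) (colour-class S s)
  colour-class-independent S s =
    (λ h → let z∈S , z≢s , _ = ∈select⁻ (in-class? S s) h in x∈p∧x≢y⇒x∈p-y z∈S z≢s) ,
    λ hu hv u~v → proper u~v (trans (colour hu) (sym (colour hv)))
    where
    colour : ∀ {z} → z ∈ colour-class S s → c z ≡ c s
    colour h = proj₂ (proj₂ (∈select⁻ (in-class? S s) h))

  -- If G[S] and G[S] \ s are well-covered and s has a neighbour in S, then some
  -- neighbour i of s is a leaf at s: take i in a maximal independent set of
  -- G[S] \ s containing the colour class of s; any other neighbour of i has the
  -- colour of s, so lies in that set too, contradicting independence.
  leaf-at-shedding-vertex : ∀ {S s t} → WC S → WC (S - s) → s ∈ S → t ∈ S → Adj s t →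
                            ∃ λ w → w ∈ S × Leaf S w s
  leaf-at-shedding-vertex {S} {s} wcS wcS-s s∈S t∈S s~t
    with extend (colour-class-independent S s)
  ... | I , maxI@((I⊆S-s , neI) , _) , class⊆I
    with maximal-deletion-meets-N wcS wcS-s s∈S t∈S s~t maxI
  ... | i , i∈I , s~i = i , x∈p-y⇒x∈p (I⊆S-s i∈I) , s∈S , adj-sym s~i , only-s
    where
    only-s : ∀ {z} → z ∈ S → Adj i z → z ≡ s
    only-s {z} z∈S i~z with z ≟ s
    ... | yes z≡s = z≡s
    ... | no z≢s = ⊥-elim (neI i∈I (class⊆I z∈class) i~z)
      where
      z∈class : z ∈ colour-class S s
      z∈class = ∈select⁺ (in-class? S s) (z∈S , z≢s , sym (same-colour s~i i~z))

  ColouredLeaf : Subset n → Bool → Set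
  ColouredLeaf S b = ∃ λ ℓ → ℓ ∈ S × c ℓ ≡ b × ∃ λ p → Leaf S ℓ p

  -- At a
  -- shedding vertex s: a leaf of G[S] \ s survives unless it is adjacent to s, and
  -- then the leaf at s given by leaf-at-shedding-vertex has the same colour; if
  -- G[S] \ s is edgeless, s and its leaf neighbour are leaves of both colours.
  leaf-of-colour : ∀ {S} → VD S → (b : Bool) → Edge S → ColouredLeaf S b
  leaf-of-colour (vd-noEdges _ ne) b (x , y , x∈S , y∈S , x~y) = ⊥-elim (ne x∈S y∈S x~y)
  leaf-of-colour {S} (vd-shed wcS s s∈S vd₁ _) b edge with edge? (S - s)
  ... | yes edge₁ = leaf-avoiding-or-at-s (leaf-of-colour vd₁ b edge₁)
    where
    leaf-avoiding-or-at-s : ColouredLeaf (S - s) b → ColouredLeaf S b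
    leaf-avoiding-or-at-s (ℓ , ℓ∈S-s , cℓ≡b , p , leaf) with adj? ℓ s
    ... | no ℓ≁s = ℓ , x∈p-y⇒x∈p ℓ∈S-s , cℓ≡b , p , leaf-deletion⇒leaf leaf ℓ≁s
    ... | yes ℓ~s with leaf-at-shedding-vertex wcS (vd⇒wc vd₁) s∈S (x∈p-y⇒x∈p ℓ∈S-s) (adj-sym ℓ~s)
    ... | w , w∈S , w-leaf@(_ , w~s , _) =
          w , w∈S , trans (same-colour w~s (adj-sym ℓ~s)) cℓ≡b , s , w-leaf
  ... | no ¬edge₁ with edge-through edge ¬edge₁
  ... | t , t∈S , s~t with leaf-at-shedding-vertex wcS (vd⇒wc vd₁) s∈S t∈S s~t
  ... | w , w∈S , w-leaf@(_ , w~s , _) with c w ≟ᵇ b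
  ... | yes cw≡b = w , w∈S , cw≡b , s , w-leaf
  ... | no cw≢b =
        s , s∈S , ≢-≢⇒≡ (proper (adj-sym w~s)) cw≢b , w , w∈S , adj-sym w~s ,
        λ z∈S s~z → edgeless-deletion⇒unique-nbr wcS s∈S (λ hu hv a → ¬edge₁ (_ , _ , hu , hv , a))
                                                  w∈S z∈S (adj-sym w~s) s~z

  -- Take a leaf ℓ at p with the colour of v; either v ~ p, or v
  -- lives in the smaller link of p, and a support vertex there stays one in G[S]
  -- because its leaf has the colour of v and so shares no neighbour with p.
  support-neighbour-within : ∀ k {S v r} → ∣ S ∣ < k → VD S → v ∈ S → r ∈ S → Adj v r →
                             ∃ λ u → Adj v u × Support S u
  support-neighbour-within zero ()
  support-neighbour-within (suc k) {S} {v} {r} size vd v∈S r∈S v~r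
    with leaf-of-colour vd (c v) (v , r , v∈S , r∈S , v~r)
  ... | ℓ , ℓ∈S , cℓ≡cv , p , leaf@(p∈S , ℓ~p , _) with adj? v p
  ... | yes v~p = p , v~p , ℓ , ℓ∈S , leaf
  ... | no v≁p = lift (support-neighbour-within k smaller (vd-link vd p∈S) v∈L r∈L v~r)
    where
    cv≢cp : c v ≢ c p
    cv≢cp cv≡cp = proper ℓ~p (trans cℓ≡cv cv≡cp)
    v∈L : v ∈ S ─ N[ p ]ᴳ
    v∈L = ∈─N[]⁺ v∈S (λ { refl → cv≢cp refl }) (v≁p ∘ adj-sym)
    r∈L : r ∈ S ─ N[ p ]ᴳ
    r∈L = ∈─N[]⁺ r∈S (λ { refl → v≁p v~r }) (λ p~r → cv≢cp (sym (same-colour p~r (adj-sym v~r))))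
    smaller : ∣ S ─ N[ p ]ᴳ ∣ < k
    smaller = ≤-trans (p∩q≢∅⇒∣p─q∣<∣p∣ S N[ p ]ᴳ (p , x∈p∩q⁺ (p∈S , x∈N[x] p))) (≤-pred size)
    lift : (∃ λ u → Adj v u × Support (S ─ N[ p ]ᴳ) u) → ∃ λ u → Adj v u × Support S u
    lift (u , v~u , q , q∈L , leaf′@(_ , q~u , _)) =
      u , v~u , q , ∈S─N[x]⇒∈S q∈L ,
      leaf-link⇒leaf leaf′ q∈L
        (λ p~z q~z → cv≢cp (trans (same-colour v~u (adj-sym q~u)) (same-colour q~z (adj-sym p~z))))

  support-neighbour : ∀ {S v r} → VD S → v ∈ S → r ∈ S → Adj v r →
                      ∃ λ u → Adj v u × Support S u
  support-neighbour {S} = support-neighbour-within (suc ∣ S ∣) ≤-refl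

corollary4p3 : (n : ℕ) (G : Graph n) → IsBipartite G →
               VertexDecomposable G ⊤ → Dominating G (InShed G)
corollary4p3 n G (c , proper) vd v v∉Shed with any? (Graph.adj? G v)
... | no isolated =
      ⊥-elim (v∉Shed (GraphFacts.isolated-sheds G vd ∈⊤ (λ {z} _ v~z → isolated (z , v~z))))
... | yes (r , v~r) with Bipartite.support-neighbour G c proper vd ∈⊤ ∈⊤ v~r
... | u , v~u , u-support = u , GraphFacts.support-sheds G vd u-support , v~u
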